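{- Every Sturmian set is a tree set.
   Context: Let $A$ be a finite alphabet. For a set $S$ of words and $w\in S$ let $L(w)=\{a\in A: aw\in S\}$, $R(w)=\{a\in A: wa\in S\}$, $E(w)=\{(a,b)\in A\times A: awb\in S\}$, $r(w)=\mathrm{Card}\,R(w)$. A word $w$ is right-special if $r(w)\ge2$. An infinite word $x$ over $A$ is strict episturmian if its set of factors is closed under reversal, it has exactly one right-special factor of each length, and each right-special factor $u$ satisfies $r(u)=\mathrm{Card}(A)$ (with $L,R,r$ computed in the set of factors of $x$). A Sturmian set is the set of factors of a strict episturmian word. A set $S$ is factorial if it contains all factors of its elements, and biextendable if it is factorial and $E(w)\ne\emptyset$ for all $w\in S$. The extension graph $G(w)$ is the undirected bipartite graph with vertex set the disjoint union of a copy of $L(w)$ and a copy of $R(w)$, and an edge between $a\in L(w)$ and $b\in R(w)$ iff $(a,b)\in E(w)$. $S$ is a tree set if it is biextendable and $G(w)$ is a tree (connected and acyclic) for every $w\in S$. -}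

module Defs where

open import Data.Nat using (ℕ; zero; suc; _+_; _≤_)
open import Data.Fin using (Fin)
open import Data.List using (List; []; _∷_; _++_; [_]; length; reverse)
open import Data.List.Relation.Unary.Linked using (Linked)
open import Data.List.Relation.Unary.Unique.Propositional using (Unique)
open import Data.Product using (Σ; ∃; ∃-syntax; _×_; _,_)
open import Data.Sum using (_⊎_; inj₁; inj₂)
open import Data.Empty using (⊥)
open import Relation.Nullary using (¬_)
open import Relation.Binary.PropositionalEquality using (_≡_; _≢_)
open import Function.Bundles using (_⇔_)

Word : ℕ → Set
Word k = List (Fin k)

WordSet : ℕ → Set₁
WordSet k = Word k → Set

InfWord : ℕ → Set
InfWord k = ℕ → Fin k

window : ∀ {k} → InfWord k → ℕ → ℕ → Word k
window x i zero = []
window x i (suc n) = x i ∷ window x (suc i) n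

Fact : ∀ {k} → InfWord k → WordSet k
Fact x w = ∃[ i ] window x i (length w) ≡ w

InR : ∀ {k} → WordSet k → Word k → Fin k → Set
InR S w a = S (w ++ [ a ])

InL : ∀ {k} → WordSet k → Word k → Fin k → Set
InL S w a = S (a ∷ w)

InE : ∀ {k} → WordSet k → Word k → Fin k → Fin k → Set
InE S w a b = S (a ∷ w ++ [ b ])

RightSpecial : ∀ {k} → WordSet k → Word k → Set
RightSpecial S w = ∃[ a ] ∃[ b ] (a ≢ b × InR S w a × InR S w b)

-- Card R(w) = Card A, i.e. R(w) = A (as R(w) ⊆ A)
FullRight : ∀ {k} → WordSet k → Word k → Set
FullRight {k} S w = (a : Fin k) → InR S w a

StrictEpisturmian : ∀ {k} → InfWord k → Set
StrictEpisturmian {k} x =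
  ((w : Word k) → Fact x w → Fact x (reverse w))
  × ((n : ℕ) → ∃[ u ] (length u ≡ n × Fact x u × RightSpecial (Fact x) u
        × ((v : Word k) → length v ≡ n → Fact x v → RightSpecial (Fact x) v → v ≡ u)))
  × ((u : Word k) → Fact x u → RightSpecial (Fact x) u → FullRight (Fact x) u)

SturmianSet : ∀ {k} → WordSet k → Set
SturmianSet {k} S = ∃[ x ] (StrictEpisturmian {k} x × ((w : Word k) → S w ⇔ Fact x w))

Factorial : ∀ {k} → WordSet k → Set
Factorial {k} S = (u v w : Word k) → S (u ++ v ++ w) → S v

Biextendable : ∀ {k} → WordSet k → Set
Biextendable {k} S = Factorial S × ((w : Word k) → S w → ∃[ a ] ∃[ b ] InE S w a b)

-- Undirected graphs given by a vertex predicate and a symmetric adjacency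

data Path {V : Set} (Adj : V → V → Set) : V → V → Set where
  here : ∀ {u} → Path Adj u u
  step : ∀ {u v w} → Adj u v → Path Adj v w → Path Adj u w

Connected : {V : Set} → (V → Set) → (V → V → Set) → Set
Connected Vtx Adj = ∀ u v → Vtx u → Vtx v → Path Adj u v

IsCycle : {V : Set} → (V → V → Set) → List V → Set
IsCycle Adj [] = ⊥
IsCycle Adj (v₀ ∷ []) = ⊥
IsCycle Adj (v₀ ∷ v₁ ∷ []) = ⊥
IsCycle Adj (v₀ ∷ v₁ ∷ v₂ ∷ rest) =
  Unique (v₀ ∷ v₁ ∷ v₂ ∷ rest) × Linked Adj (v₀ ∷ v₁ ∷ v₂ ∷ rest ++ [ v₀ ])

Acyclic : {V : Set} → (V → V → Set) → Set
Acyclic {V} Adj = (c : List V) → ¬ IsCycle Adj c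

IsTree : {V : Set} → (V → Set) → (V → V → Set) → Set
IsTree Vtx Adj = Connected Vtx Adj × Acyclic Adj

-- Extension graph G(w): vertices inj₁ a (a ∈ L(w)) and inj₂ b (b ∈ R(w)),
-- edge a — b iff (a,b) ∈ E(w)
GVertex : ∀ {k} → WordSet k → Word k → Fin k ⊎ Fin k → Set
GVertex S w (inj₁ a) = InL S w a
GVertex S w (inj₂ b) = InR S w b

GAdj : ∀ {k} → WordSet k → Word k → Fin k ⊎ Fin k → Fin k ⊎ Fin k → Set
GAdj S w (inj₁ a) (inj₁ a') = ⊥
GAdj S w (inj₁ a) (inj₂ b) = InE S w a b
GAdj S w (inj₂ b) (inj₁ a) = InE S w a b
GAdj S w (inj₂ b) (inj₂ b') = ⊥

TreeSet : ∀ {k} → WordSet k → Set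
TreeSet {k} S = Biextendable S × ((w : Word k) → S w → IsTree (GVertex S w) (GAdj S w))

-- For w in a Sturmian set S there is a letter c such that cw extends by every
-- letter of R(w), while no other aw is right-special: either w itself is not
-- right-special (so R(w) is a singleton), or c is the first letter of the right-special
-- factor of length |w|+1, which is a full extension.  Dually, by closure under
-- reversal, there is a letter d such that aw d ∈ S for every a ∈ L(w).  Every edge
-- (a, b) of G(w) then has a = c or b = d, so G(w) is a double star centred on the
-- edge (c, d): connected, and with only two vertices of degree ≥ 2, hence acyclic.
module Submission where

open import Defs
open import Data.Nat using (ℕ; suc; pred)
open import Data.Fin using (Fin)
open import Data.Fin.Properties using (_≟_)
open import Data.List using (List; []; _∷_; _++_; [_]; length; reverse)
open import Data.List.Properties
  using (++-identityʳ; reverse-++; reverse-involutive; unfold-reverse; ∷-injective; ≡-dec)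
open import Data.List.Relation.Unary.Linked using (Linked; [-]; _∷_)
open import Data.List.Relation.Unary.AllPairs using (_∷_)
open import Data.List.Relation.Unary.All using (All; []; _∷_)
open import Data.Product using (∃-syntax; _×_; _,_; proj₁; proj₂)
open import Data.Sum using (_⊎_; inj₁; inj₂)
open import Data.Empty using (⊥; ⊥-elim)
open import Relation.Nullary using (¬_; yes; no)
open import Relation.Binary.PropositionalEquality
  using (_≡_; _≢_; refl; sym; trans; cong; subst; ≢-sym; module ≡-Reasoning)
open import Function.Bundles using (_⇔_; Equivalence)

module _ {k : ℕ} (x : InfWord k) where

  Fact-∷⁻ : ∀ a w → Fact x (a ∷ w) → Fact x w
  Fact-∷⁻ a w (i , eq) = suc i , proj₂ (∷-injective eq)

  Fact-++⁻ʳ : ∀ u w → Fact x (u ++ w) → Fact x w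
  Fact-++⁻ʳ []      w f = f
  Fact-++⁻ʳ (a ∷ u) w f = Fact-++⁻ʳ u w (Fact-∷⁻ a (u ++ w) f)

  window-++⁻ˡ : ∀ i u w → window x i (length (u ++ w)) ≡ u ++ w → window x i (length u) ≡ u
  window-++⁻ˡ i []      w eq = refl
  window-++⁻ˡ i (a ∷ u) w eq with ∷-injective eq
  ... | refl , eq′ = cong (a ∷_) (window-++⁻ˡ (suc i) u w eq′)

  Fact-++⁻ˡ : ∀ u w → Fact x (u ++ w) → Fact x u
  Fact-++⁻ˡ u w (i , eq) = i , window-++⁻ˡ i u w eq

  Fact-factorial : Factorial (Fact x)
  Fact-factorial u v w f = Fact-++⁻ˡ v w (Fact-++⁻ʳ u (v ++ w) f)

  window-extend : ∀ i w → window x i (length w) ≡ w → ∃[ b ] window x i (length (w ++ [ b ])) ≡ w ++ [ b ]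
  window-extend i []      eq = x i , refl
  window-extend i (a ∷ w) eq with ∷-injective eq
  ... | refl , eq′ with window-extend (suc i) w eq′
  ...   | b , eq″ = b , cong (a ∷_) eq″

  Fact-rightExtendable : ∀ w → Fact x w → ∃[ b ] InR (Fact x) w b
  Fact-rightExtendable w (i , eq) with window-extend i w eq
  ... | b , eq′ = b , (i , eq′)

RightSpecial-mono : ∀ {k} {S T : WordSet k} → (∀ w → S w → T w) →
                    ∀ u → RightSpecial S u → RightSpecial T u
RightSpecial-mono S⊆T u (a , b , a≢b , ua , ub) = a , b , a≢b , S⊆T _ ua , S⊆T _ ub

-- The only properties of the factor set of a strict episturmian word that are used.
record SturmianAxioms {k : ℕ} (S : WordSet k) : Set where
  field
    factorial           : Factorial S
    rightExtendable     : ∀ w → S w → ∃[ b ] InR S w b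
    reverse-closed      : ∀ w → S w → S (reverse w)
    rightSpecial-exists : ∀ n → ∃[ u ] (length u ≡ n × S u × RightSpecial S u)
    rightSpecial-unique : ∀ {u v} → length u ≡ length v → S u → S v →
                          RightSpecial S u → RightSpecial S v → u ≡ v
    rightSpecial-full   : ∀ u → S u → RightSpecial S u → FullRight S u

strictEpisturmian⇒sturmianAxioms : ∀ {k} {x : InfWord k} → StrictEpisturmian x → SturmianAxioms (Fact x)
strictEpisturmian⇒sturmianAxioms {x = x} (rev , unique , full) = record
  { factorial           = Fact-factorial x
  ; rightExtendable     = Fact-rightExtendable x
  ; reverse-closed      = rev
  ; rightSpecial-exists = λ n → let (u , |u| , fu , rs , _) = unique n in u , |u| , fu , rs
  ; rightSpecial-unique = λ {u} {v} |u|≡|v| fu fv rsu rsv →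
      let (_ , _ , _ , _ , onlyOne) = unique (length v)
      in trans (onlyOne u |u|≡|v| fu rsu) (sym (onlyOne v refl fv rsv))
  ; rightSpecial-full   = full
  }

sturmianAxioms-resp-⇔ : ∀ {k} {S T : WordSet k} → (∀ w → S w ⇔ T w) → SturmianAxioms T → SturmianAxioms S
sturmianAxioms-resp-⇔ {S = S} {T} S⇔T ax = record
  { factorial           = λ u v w s → from v (factorial u v w (to _ s))
  ; rightExtendable     = λ w s → let (b , t) = rightExtendable w (to w s) in b , from _ t
  ; reverse-closed      = λ w s → from _ (reverse-closed w (to w s))
  ; rightSpecial-exists = λ n → let (u , |u| , t , rs) = rightSpecial-exists n
                                in u , |u| , from u t , RightSpecial-mono {S = T} from u rs
  ; rightSpecial-unique = λ {u} {v} |u|≡|v| su sv rsu rsv →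
      rightSpecial-unique |u|≡|v| (to u su) (to v sv) (T-rs u rsu) (T-rs v rsv)
  ; rightSpecial-full   = λ u s rs a → from _ (rightSpecial-full u (to u s) (T-rs u rs) a)
  }
  where
  open SturmianAxioms ax
  to : ∀ w → S w → T w
  to w = Equivalence.to (S⇔T w)
  from : ∀ w → T w → S w
  from w = Equivalence.from (S⇔T w)
  T-rs : ∀ u → RightSpecial S u → RightSpecial T u
  T-rs = RightSpecial-mono {S = S} to

_◅◅_ : ∀ {V : Set} {Adj : V → V → Set} {u v w} → Path Adj u v → Path Adj v w → Path Adj u w
here     ◅◅ q = q
step e p ◅◅ q = step e (p ◅◅ q)

module _ {V : Set} where

  pair-noThreeDistinct : ∀ {p q u v w : V} → (u ≡ p ⊎ u ≡ q) → (v ≡ p ⊎ v ≡ q) → (w ≡ p ⊎ w ≡ q) →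
                         u ≢ v → v ≢ w → u ≢ w → ⊥
  pair-noThreeDistinct (inj₁ refl) (inj₁ refl) _           u≢v _   _   = u≢v refl
  pair-noThreeDistinct (inj₂ refl) (inj₂ refl) _           u≢v _   _   = u≢v refl
  pair-noThreeDistinct _           (inj₁ refl) (inj₁ refl) _   v≢w _   = v≢w refl
  pair-noThreeDistinct _           (inj₂ refl) (inj₂ refl) _   v≢w _   = v≢w refl
  pair-noThreeDistinct (inj₁ refl) _           (inj₁ refl) _   _   u≢w = u≢w refl
  pair-noThreeDistinct (inj₂ refl) _           (inj₂ refl) _   _   u≢w = u≢w refl

  -- Each vertex of a cycle has two distinct neighbours on it, and a cycle has at
  -- least three vertices.
  twoBranchPoints⇒acyclic : {Adj : V → V → Set} → (∀ {u v} → Adj u v → Adj v u) → (p q : V) →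
    (∀ {u v v′} → Adj u v → Adj u v′ → v ≢ v′ → u ≡ p ⊎ u ≡ q) → Acyclic Adj
  twoBranchPoints⇒acyclic {Adj} sym-adj p q branch = acyclic
    where
    acyclic : Acyclic Adj
    acyclic (v₀ ∷ v₁ ∷ v₂ ∷ []) ((v₀≢v₁ ∷ v₀≢v₂ ∷ []) ∷ (v₁≢v₂ ∷ []) ∷ _ , e₀₁ ∷ e₁₂ ∷ e₂₀ ∷ [-]) =
      pair-noThreeDistinct
        (branch e₀₁ (sym-adj e₂₀) v₁≢v₂)
        (branch (sym-adj e₀₁) e₁₂ v₀≢v₂)
        (branch (sym-adj e₁₂) e₂₀ (≢-sym v₀≢v₁))
        v₀≢v₁ v₁≢v₂ v₀≢v₂
    acyclic (v₀ ∷ v₁ ∷ v₂ ∷ v₃ ∷ rest)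
            ((_ ∷ v₀≢v₂ ∷ _) ∷ (v₁≢v₂ ∷ v₁≢v₃ ∷ _) ∷ (v₂≢v₃ ∷ v₂∉rest) ∷ _ , e₀₁ ∷ e₁₂ ∷ e₂₃ ∷ cycle) =
      pair-noThreeDistinct
        (branch (sym-adj e₀₁) e₁₂ v₀≢v₂)
        (branch (sym-adj e₁₂) e₂₃ v₁≢v₃)
        (branch (sym-adj e₂₃) (edge-after-v₃ rest cycle) (v₂≢after-v₃ rest v₂∉rest))
        v₁≢v₂ v₂≢v₃ v₁≢v₃
      where
      after-v₃ : List V → V
      after-v₃ []      = v₀
      after-v₃ (v ∷ _) = v
      edge-after-v₃ : ∀ vs → Linked Adj (v₃ ∷ vs ++ [ v₀ ]) → Adj v₃ (after-v₃ vs)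
      edge-after-v₃ []      (e ∷ _) = e
      edge-after-v₃ (_ ∷ _) (e ∷ _) = e
      v₂≢after-v₃ : ∀ vs → All (v₂ ≢_) vs → v₂ ≢ after-v₃ vs
      v₂≢after-v₃ []      _         v₂≡v₀ = v₀≢v₂ (sym v₂≡v₀)
      v₂≢after-v₃ (_ ∷ _) (v₂≢v ∷ _) = v₂≢v

module _ {k : ℕ} (S : WordSet k) (w : Word k) where

  GAdj-sym : ∀ {u v} → GAdj S w u v → GAdj S w v u
  GAdj-sym {inj₁ _} {inj₂ _} e = e
  GAdj-sym {inj₂ _} {inj₁ _} e = e

  doubleStar⇒isTree : ∀ {c d} → InL S w c → (∀ b → InR S w b → InE S w c b) →
    (∀ a → InL S w a → InE S w a d) → (∀ a b → InE S w a b → a ≡ c ⊎ b ≡ d) →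
    IsTree (GVertex S w) (GAdj S w)
  doubleStar⇒isTree {c} {d} c∈L c-extendsR d-extendsL edge =
    connected , twoBranchPoints⇒acyclic (λ {u} {v} → GAdj-sym {u} {v}) (inj₁ c) (inj₂ d) branch
    where
    toHub : ∀ u → GVertex S w u → Path (GAdj S w) u (inj₁ c)
    toHub (inj₁ a) a∈L = step {v = inj₂ d} (d-extendsL a a∈L) (step (d-extendsL c c∈L) here)
    toHub (inj₂ b) b∈R = step (c-extendsR b b∈R) here

    fromHub : ∀ u → GVertex S w u → Path (GAdj S w) (inj₁ c) u
    fromHub (inj₁ a) a∈L = step {v = inj₂ d} (d-extendsL c c∈L) (step (d-extendsL a a∈L) here)
    fromHub (inj₂ b) b∈R = step (c-extendsR b b∈R) here

    connected : Connected (GVertex S w) (GAdj S w)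
    connected u v u∈G v∈G = toHub u u∈G ◅◅ fromHub v v∈G

    branch : ∀ {u v v′} → GAdj S w u v → GAdj S w u v′ → v ≢ v′ → u ≡ inj₁ c ⊎ u ≡ inj₂ d
    branch {inj₁ a} {inj₂ b} {inj₂ b′} e e′ b≢b′ with edge a b e | edge a b′ e′
    ... | inj₁ refl | _         = inj₁ refl
    ... | inj₂ _    | inj₁ refl = inj₁ refl
    ... | inj₂ refl | inj₂ refl = ⊥-elim (b≢b′ refl)
    branch {inj₂ b} {inj₁ a} {inj₁ a′} e e′ a≢a′ with edge a b e | edge a′ b e′
    ... | inj₂ refl | _         = inj₂ refl
    ... | inj₁ _    | inj₂ refl = inj₂ refl
    ... | inj₁ refl | inj₁ refl = ⊥-elim (a≢a′ refl)

reverse-reverse-∷ʳ : ∀ {A : Set} (w : List A) a → reverse (reverse w ++ [ a ]) ≡ a ∷ w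
reverse-reverse-∷ʳ w a = begin
  reverse (reverse w ++ [ a ])     ≡⟨ reverse-++ (reverse w) [ a ] ⟩
  a ∷ reverse (reverse w)          ≡⟨ cong (a ∷_) (reverse-involutive w) ⟩
  a ∷ w                            ∎
  where open ≡-Reasoning

reverse-∷-reverse-∷ʳ : ∀ {A : Set} (w : List A) a b → reverse (b ∷ reverse w ++ [ a ]) ≡ a ∷ w ++ [ b ]
reverse-∷-reverse-∷ʳ w a b = begin
  reverse (b ∷ reverse w ++ [ a ])     ≡⟨ unfold-reverse b (reverse w ++ [ a ]) ⟩
  reverse (reverse w ++ [ a ]) ++ [ b ] ≡⟨ cong (_++ [ b ]) (reverse-reverse-∷ʳ w a) ⟩
  a ∷ w ++ [ b ]                       ∎
  where open ≡-Reasoning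

module SturmianSetProperties {k : ℕ} {S : WordSet k} (ax : SturmianAxioms S) where
  open SturmianAxioms ax

  InL⇒S : ∀ {w a} → InL S w a → S w
  InL⇒S {w} {a} s = factorial [ a ] w [] (subst S (cong (a ∷_) (sym (++-identityʳ w))) s)

  InR⇒S : ∀ {w b} → InR S w b → S w
  InR⇒S {w} {b} = factorial [] w [ b ]

  InL⇒InR-reverse : ∀ {w a} → InL S w a → InR S (reverse w) a
  InL⇒InR-reverse {w} {a} s = subst S (unfold-reverse a w) (reverse-closed (a ∷ w) s)

  InE-reverse⇒InE : ∀ {w a b} → InE S (reverse w) b a → InE S w a b
  InE-reverse⇒InE {w} {a} {b} s = subst S (reverse-∷-reverse-∷ʳ w a b) (reverse-closed _ s)

  leftExtendable : ∀ w → S w → ∃[ a ] InL S w a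
  leftExtendable w s with rightExtendable (reverse w) (reverse-closed w s)
  ... | a , s′ = a , subst S (reverse-reverse-∷ʳ w a) (reverse-closed _ s′)

  rightSpecial-∷⁻ : ∀ {a w} → RightSpecial S (a ∷ w) → RightSpecial S w
  rightSpecial-∷⁻ (b , b′ , b≢b′ , s , s′) = b , b′ , b≢b′ , InL⇒S s , InL⇒S s′

  biextendable : Biextendable S
  biextendable = factorial , λ w s →
    let (a , a∈L) = leftExtendable w s ; (b , e) = rightExtendable (a ∷ w) a∈L in a , b , e

  record LeftHub (w : Word k) (c : Fin k) : Set where
    field
      c∈L              : InL S w c
      extendsR         : ∀ b → InR S w b → InE S w c b
      othersNotSpecial : ∀ a → a ≢ c → InL S w a → ¬ RightSpecial S (a ∷ w)
  open LeftHub

  rightSpecial⇒leftHub : ∀ {w c} → InL S w c → RightSpecial S (c ∷ w) → LeftHub w c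
  rightSpecial⇒leftHub c∈L rs = record
    { c∈L              = c∈L
    ; extendsR         = λ b _ → rightSpecial-full _ c∈L rs b
    ; othersNotSpecial = λ a a≢c a∈L rs′ → a≢c (proj₁ (∷-injective (rightSpecial-unique refl a∈L c∈L rs′ rs)))
    }

  notRightSpecial⇒leftHub : ∀ {w c} → ¬ RightSpecial S w → InL S w c → LeftHub w c
  notRightSpecial⇒leftHub {w} {c} ¬rs c∈L = record
    { c∈L              = c∈L
    ; extendsR         = extendsR′
    ; othersNotSpecial = λ _ _ _ rs → ¬rs (rightSpecial-∷⁻ rs)
    }
    where
    extendsR′ : ∀ b → InR S w b → InE S w c b
    extendsR′ b b∈R with rightExtendable (c ∷ w) c∈L
    ... | b₀ , e with b ≟ b₀
    ...   | yes refl = e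
    ...   | no b≢b₀  = ⊥-elim (¬rs (b , b₀ , b≢b₀ , b∈R , InL⇒S e))

  -- Compare w with the suffix u′ of the right-special factor c u′ of length |w| + 1.
  leftHub : ∀ w → S w → ∃[ c ] LeftHub w c
  leftHub w s with rightSpecial-exists (suc (length w))
  ... | [] , () , _
  ... | c ∷ u′ , |cu′| , cu′∈S , rs with ≡-dec _≟_ u′ w
  ...   | yes refl = c , rightSpecial⇒leftHub cu′∈S rs
  ...   | no u′≢w  = let (c′ , c′∈L) = leftExtendable w s in c′ , notRightSpecial⇒leftHub ¬rs c′∈L
    where
    ¬rs : ¬ RightSpecial S w
    ¬rs rs-w = u′≢w (rightSpecial-unique (cong pred |cu′|) (InL⇒S cu′∈S) s (rightSpecial-∷⁻ rs) rs-w)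

  rightHub : ∀ w → S w → ∃[ d ] (∀ a → InL S w a → InE S w a d)
  rightHub w s with leftHub (reverse w) (reverse-closed w s)
  ... | d , hub = d , λ a a∈L → InE-reverse⇒InE (extendsR hub a (InL⇒InR-reverse a∈L))

  edge-throughHubs : ∀ {w c d} → LeftHub w c → (∀ a → InL S w a → InE S w a d) →
                     ∀ a b → InE S w a b → a ≡ c ⊎ b ≡ d
  edge-throughHubs {c = c} {d} hub d-extendsL a b e with a ≟ c | b ≟ d
  ... | yes a≡c | _       = inj₁ a≡c
  ... | no _    | yes b≡d = inj₂ b≡d
  ... | no a≢c  | no b≢d  =
    ⊥-elim (othersNotSpecial hub a a≢c (InR⇒S e) (b , d , b≢d , e , d-extendsL a (InR⇒S e)))

  treeSet : TreeSet S
  treeSet = biextendable , λ w s →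
    let (c , hub) = leftHub w s ; (d , d-extendsL) = rightHub w s
    in doubleStar⇒isTree S w (c∈L hub) (extendsR hub) d-extendsL (edge-throughHubs hub d-extendsL)

proposition4p1 : (k : ℕ) (S : WordSet k) → SturmianSet S → TreeSet S
proposition4p1 k S (x , episturmian , S⇔Fact) =
  SturmianSetProperties.treeSet (sturmianAxioms-resp-⇔ S⇔Fact (strictEpisturmian⇒sturmianAxioms episturmian))
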